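{- Given a safe loop invariant $I$ and a correct summary $R$ for a loop $W(t,B)$ with respect to precondition $P$ and postcondition $Q$, the Hoare triple $\{P\}\,W(t,B)\,\{Q\}$ is valid, i.e. $\models \{P\}\,W(t,B)\,\{Q\}$.
   Context: States form a set $S$. Commands are relations $C \subseteq S \times \hat S$ with $\hat S = S \uplus \{\mathsf{err}\} \uplus \{\mathrm{brk}(s) \mid s \in S\}$, where $\mathsf{err}$ denotes a runtime error outcome and $\mathrm{brk}(s)$ denotes early exit of a loop via a break command in state $s$; $s,s',s_0,s_n$ range over $S$ and $\hat s$ over $\hat S$. Validity: $\models \{P\}\,C\,\{Q\}$ iff for all $s,\hat s'$, $P(s) \land C(s,\hat s') \implies Q(\hat s')$, where $P,Q \subseteq S$ (so $\hat s'$ must be a regular state). The loop $W(t,B)\subseteq S\times\hat S$ with test $t\subseteq S$ and body $B\subseteq S\times\hat S$ is the least relation satisfying: $\lnot t(s) \implies W(t,B)(s,s)$; $t(s)\land B(s,\mathsf{err}) \implies W(t,B)(s,\mathsf{err})$; $t(s)\land B(s,\mathrm{brk}(s')) \implies W(t,B)(s,s')$; $t(s)\land B(s,s')\land W(t,B)(s',\hat s'') \implies W(t,B)(s,\hat s'')$. A predicate $I\subseteq S$ is an invariant w.r.t. $P$ if $P(s_0)\implies I(s_0)$ and $I(s)\land t(s)\land B(s,s')\implies I(s')$; it is safe if additionally $I(s)\land t(s)\land B(s,\mathsf{err})\implies \mathit{false}$. A relation $R\subseteq S\times S$ is a summary of $W(t,B)$ if $\lnot t(s_n)\implies R(s_n,s_n)$;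 $t(s)\land B(s,\mathrm{brk}(s_n))\implies R(s,s_n)$; $t(s)\land B(s,s')\land R(s',s_n)\implies R(s,s_n)$. A summary is correct w.r.t. $P$ and $Q$ if also $P(s_0)\land R(s_0,s_n)\implies Q(s_n)$. -}

module Defs where

open import Level using (Level; _⊔_; suc)
import Level
open import Data.Empty using (⊥)
open import Relation.Nullary using (¬_)

data Ŝ {a : Level} (S : Set a) : Set a where
  reg : S → Ŝ S
  err : Ŝ S
  brk : S → Ŝ S

module _ {a : Level} {S : Set a} where
  private ℓ = a

  Cmd : Set (a ⊔ suc ℓ)
  Cmd = S → Ŝ S → Set ℓ

  Pred : Set (a ⊔ suc ℓ)
  Pred = S → Set ℓ

  Holds : Pred → Ŝ S → Set ℓ
  Holds Q (reg s) = Q s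
  Holds Q err     = Level.Lift ℓ ⊥
  Holds Q (brk s) = Level.Lift ℓ ⊥

  ⊨⟨_⟩_⟨_⟩ : Pred → Cmd → Pred → Set (a ⊔ ℓ)
  ⊨⟨ P ⟩ C ⟨ Q ⟩ = ∀ s s' → P s → C s s' → Holds Q s'

  data W (t : Pred) (B : Cmd) : S → Ŝ S → Set (a ⊔ ℓ) where
    w-exit  : ∀ {s} → ¬ t s → W t B s (reg s)
    w-err   : ∀ {s} → t s → B s err → W t B s err
    w-brk   : ∀ {s s'} → t s → B s (brk s') → W t B s (reg s')
    w-step  : ∀ {s s' ŝ''} → t s → B s (reg s') → W t B s' ŝ'' → W t B s ŝ''

  record Invariant (t : Pred) (B : Cmd) (P I : Pred) : Set (a ⊔ ℓ) where
    field
      init     : ∀ s₀ → P s₀ → I s₀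
      preserve : ∀ s s' → I s → t s → B s (reg s') → I s'

  record SafeInvariant (t : Pred) (B : Cmd) (P I : Pred) : Set (a ⊔ ℓ) where
    field
      invariant : Invariant t B P I
      safe      : ∀ s → I s → t s → B s err → ⊥

  record Summary (t : Pred) (B : Cmd) (R : S → S → Set ℓ) : Set (a ⊔ ℓ) where
    field
      exit  : ∀ sₙ → ¬ t sₙ → R sₙ sₙ
      break : ∀ s sₙ → t s → B s (brk sₙ) → R s sₙ
      step  : ∀ s s' sₙ → t s → B s (reg s') → R s' sₙ → R s sₙ

  record CorrectSummary (t : Pred) (B : Cmd) (P Q : Pred) (R : S → S → Set ℓ) : Set (a ⊔ ℓ) where
    field
      summary : Summary t B R
      correct : ∀ s₀ sₙ → P s₀ → R s₀ sₙ → Q sₙ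

{-# OPTIONS --safe #-}
-- By induction on the derivation of W(t,B)(s, ŝ), from an invariant state the loop ends
-- in a regular state R-related to s: safety excludes the error rule, the invariant is
-- carried along the step rule, and every other rule of W matches a closure rule of R.
module Submission where

open import Defs
open import Level using (Level)
open import Data.Empty using (⊥-elim)

module _ {a : Level} {S : Set a} where

  Holds-map : {P Q : S → Set a} → (∀ {s} → P s → Q s) → ∀ ŝ → Holds P ŝ → Holds Q ŝ
  Holds-map f (reg s) p = f p
  Holds-map f err     ()
  Holds-map f (brk _) ()

module _ {a : Level} {S : Set a} {t : S → Set a} {B : S → Ŝ S → Set a}
         {P I : S → Set a} {R : S → S → Set a}
         (si : SafeInvariant t B P I) (sm : Summary t B R) where

  open SafeInvariant si
  open Invariant invariant
  open Summary sm

  W-summarised : ∀ {s ŝ} → I s → W t B s ŝ → Holds (R s) ŝ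
  W-summarised {s} i (w-exit ¬ts)                = exit s ¬ts
  W-summarised {s} i (w-err ts b)                = ⊥-elim (safe s i ts b)
  W-summarised {s} i (w-brk {s' = s'} ts b)      = break s s' ts b
  W-summarised {s} i (w-step {s' = s'} {ŝ} ts b w) =
    Holds-map (step s s' _ ts b) ŝ (W-summarised (preserve s s' i ts b) w)

theorem3 : {a : Level} {S : Set a} (t : S → Set a) (B : S → Ŝ S → Set a)
           (P Q I : S → Set a) (R : S → S → Set a) →
           SafeInvariant t B P I → CorrectSummary t B P Q R →
           ⊨⟨ P ⟩ W t B ⟨ Q ⟩
theorem3 t B P Q I R si cs s ŝ p w =
  Holds-map (correct s _ p) ŝ (W-summarised si summary (init s p) w)
  where
  open CorrectSummary cs
  open Invariant (SafeInvariant.invariant si)
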